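{- Let $a_n$ be the number of odd permutations in $\mathscr{G}_n$. Then $a_1=0$, $a_2=1$, and \[ a_n=2a_{n-2}+2^{n-2}\quad\text{for } n>2. \]
   Context: A permutation is Grassmannian if it has at most one descent (a position $i$ with $\pi(i)>\pi(i+1)$); $\mathscr{G}_n$ is the set of Grassmannian permutations of $[n]$. A permutation is odd (resp. even) if its number of inversions (pairs $i<j$ with $\pi(i)>\pi(j)$) is odd (resp. even). -}

module Defs where

open import Data.Nat using (ℕ; zero; suc; _<ᵇ_; _+_)
open import Data.Nat.Properties using (_≟_)
open import Data.Bool using (Bool; true; false; _∧_; _∨_; not; if_then_else_)
open import Data.Bool.ListAction using (and)
open import Data.Fin using (Fin; toℕ)
open import Data.List using (List; []; _∷_; map; concatMap; filterᵇ; length; allFin)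
open import Data.Vec using (Vec; []; _∷_; lookup)
open import Data.Nat using (_≡ᵇ_)

words : (n k : ℕ) → List (Vec (Fin n) k)
words n zero    = [] ∷ []
words n (suc k) = concatMap (λ w → map (λ a → a ∷ w) (allFin n)) (words n k)

count : ∀ {A : Set} → (A → Bool) → List A → ℕ
count p xs = length (filterᵇ p xs)

-- w is injective (hence a permutation of [n], since it maps [n] to [n]).
isPerm : ∀ {n} → Vec (Fin n) n → Bool
isPerm {n} w =
  and (map (λ i → and (map (λ j → (toℕ i ≡ᵇ toℕ j) ∨ not (toℕ (lookup w i) ≡ᵇ toℕ (lookup w j))) (allFin n))) (allFin n))

inversions : ∀ {n} → Vec (Fin n) n → ℕ
inversions {n} w =
  length (concatMap (λ i → filterᵇ (λ j → (toℕ i <ᵇ toℕ j) ∧ (toℕ (lookup w j) <ᵇ toℕ (lookup w i))) (allFin n)) (allFin n))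

descents : ∀ {n} → Vec (Fin n) n → ℕ
descents {n} w =
  length (concatMap (λ i → filterᵇ (λ j → (suc (toℕ i) ≡ᵇ toℕ j) ∧ (toℕ (lookup w j) <ᵇ toℕ (lookup w i))) (allFin n)) (allFin n))

isOdd : ℕ → Bool
isOdd zero = false
isOdd (suc k) = if isOdd k then false else true

-- Grassmannian: at most one descent.
atMostOne : ℕ → Bool
atMostOne zero = true
atMostOne (suc zero) = true
atMostOne (suc (suc _)) = false

a : ℕ → ℕ
a n = count (λ w → isPerm w ∧ atMostOne (descents w) ∧ isOdd (inversions w)) (words n n)

{-# OPTIONS --safe #-}
module Submission where

-- A permutation with at most one descent is an increasing run followed by another one, so
-- it is determined by the set of values in its first run.  Writing that set as its indicator
-- word bs ∈ {0,1}ⁿ, the permutation is  shuffle bs  (the positions of the 1s, then those of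
-- the 0s), and its inversions are exactly the pairs "a 0 before a 1" of bs.  Words without
-- such a pair all give the identity, but every other word gives a different permutation, so
-- a n counts the words of length n with an odd number of these pairs.  Prepending a 0 adds
-- the number of 1s to that count, while prepending a 1 adds one more 1; following both
-- parities through two prepended letters gives a (n + 2) = 2 a n + 2 ^ n.

open import Defs
open import Data.Bool using (Bool; true; false; _∧_; _∨_; not; _xor_; if_then_else_; T)
open import Data.Bool.ListAction using (and)
open import Data.Bool.Properties using (∧-assoc; ∧-idem; ∧-comm; T-∧; T-∨; T-≡; not-distribˡ-xor; xor-assoc; xor-same)
open import Data.Empty using (⊥-elim)
open import Data.Fin using (Fin; toℕ; fromℕ<) renaming (zero to fzero; suc to fsuc)
open import Data.Fin.Properties using (toℕ-injective; toℕ<n; toℕ-fromℕ<)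
open import Data.List using (List; []; _∷_; _++_; map; length; filterᵇ; tabulate; allFin; concatMap; cartesianProductWith)
open import Data.List.Membership.Propositional using (_∈_; _∉_)
open import Data.List.Membership.Propositional.Properties
  using (∈-map⁺; ∈-map⁻; ∈-filter⁺; ∈-filter⁻; ∈-++⁺ˡ; ∈-++⁺ʳ; ∈-++⁻; ∈-allFin; ∈-cartesianProductWith⁺; ∈-cartesianProductWith⁻)
open import Data.List.Properties
  using (length-++; length-map; filter-++; filter-none; filter-all; length-removeAt′; map-∘; map-id-local; map-cong-local;
         ∷-injective; ∷-injectiveˡ; ∷-injectiveʳ; map-tabulate; tabulate-cong)
open import Data.List.Relation.Binary.Disjoint.Propositional using (Disjoint)
open import Data.List.Relation.Binary.Subset.Propositional using (_⊆_)
open import Data.List.Relation.Unary.All as All using (All; []; _∷_)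
import Data.List.Relation.Unary.All.Properties as All
open import Data.List.Relation.Unary.AllPairs as AllPairs using (AllPairs; []; _∷_)
import Data.List.Relation.Unary.AllPairs.Properties as AllPairs
open import Data.List.Relation.Unary.Any using (here; there; index; _─_)
open import Data.List.Relation.Unary.Unique.Propositional using (Unique)
import Data.List.Relation.Unary.Unique.Propositional.Properties as Unique
open import Data.Nat using (ℕ; zero; suc; _+_; _*_; _^_; _>_; _∸_; _≤_; _<_; z≤n; s≤s; s≤s⁻¹; z<s; _<ᵇ_; _≡ᵇ_)
open import Data.Nat.ListAction using (sum)
open import Data.Nat.Properties
open import Algebra.Properties.CommutativeSemigroup +-commutativeSemigroup using (x∙yz≈y∙xz)
open import Data.List.Membership.DecPropositional _≟_ using (_∈?_)
open import Data.Nat.Tactic.RingSolver using (solve-∀)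
open import Data.Product using (_×_; _,_; proj₁; proj₂; ∃; swap; map₁)
open import Data.Sum using ([_,_]′; inj₁; inj₂)
open import Data.Vec using (Vec; []; _∷_; lookup)
import Data.Vec.Properties as Vec
open import Function using (_∘_; Equivalence)
open import Relation.Binary.PropositionalEquality
open import Relation.Nullary using (¬_; yes; no)
open import Relation.Nullary.Decidable using (T?)

open Equivalence using (to; from)

private variable
  A B C : Set

-- Counting in lists

count-++ : (p : A → Bool) (xs ys : List A) → count p (xs ++ ys) ≡ count p xs + count p ys
count-++ p xs ys = trans (cong length (filter-++ (T? ∘ p) xs ys)) (length-++ (filterᵇ p xs))

count-map : (p : B → Bool) (f : A → B) (xs : List A) → count p (map f xs) ≡ count (p ∘ f) xs
count-map p f [] = refl
count-map p f (x ∷ xs) with p (f x)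
... | true  = cong suc (count-map p f xs)
... | false = count-map p f xs

count-cong : {p q : A → Bool} → (∀ x → p x ≡ q x) → (xs : List A) → count p xs ≡ count q xs
count-cong p≗q [] = refl
count-cong {q = q} p≗q (x ∷ xs) rewrite p≗q x with q x
... | true  = cong suc (count-cong p≗q xs)
... | false = count-cong p≗q xs

count-none : (p : A → Bool) {xs : List A} → All (λ x → ¬ T (p x)) xs → count p xs ≡ 0
count-none p none = cong length (filter-none (T? ∘ p) none)

count-all : (p : A → Bool) {xs : List A} → All (λ x → T (p x)) xs → count p xs ≡ length xs
count-all p all = cong length (filter-all (T? ∘ p) all)

count≢0⇒∃ : (p : A → Bool) (xs : List A) → count p xs ≢ 0 → ∃ λ x → x ∈ xs × T (p x)
count≢0⇒∃ p [] c≢0 = ⊥-elim (c≢0 refl)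
count≢0⇒∃ p (x ∷ xs) c≢0 with p x in px
... | true  = x , here refl , subst T (sym px) _
... | false = let y , y∈ , py = count≢0⇒∃ p xs c≢0 in y , there y∈ , py

count-not+count : (p : A → Bool) (xs : List A) → count (not ∘ p) xs + count p xs ≡ length xs
count-not+count p []       = refl
count-not+count p (x ∷ xs) with p x
... | true  = trans (+-suc _ _) (cong suc (count-not+count p xs))
... | false = cong suc (count-not+count p xs)

∈-─⁺ : {x y : A} {ys : List A} (x∈ys : x ∈ ys) → y ∈ ys → y ≢ x → y ∈ (ys ─ x∈ys)
∈-─⁺ (here refl) (here refl) y≢x = ⊥-elim (y≢x refl)
∈-─⁺ (here refl) (there y∈ys) _  = y∈ys
∈-─⁺ (there x∈ys) (here refl) _  = here refl
∈-─⁺ (there x∈ys) (there y∈ys) y≢x = there (∈-─⁺ x∈ys y∈ys y≢x)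

Unique-⊆⇒length≤ : {xs ys : List A} → Unique xs → xs ⊆ ys → length xs ≤ length ys
Unique-⊆⇒length≤ {xs = []} _ _ = z≤n
Unique-⊆⇒length≤ {xs = x ∷ xs} {ys} (x∉xs ∷ u) xs⊆ys =
  subst (suc (length xs) ≤_) (sym (length-removeAt′ ys (index x∈ys)))
    (s≤s (Unique-⊆⇒length≤ u λ z∈xs →
      ∈-─⁺ x∈ys (xs⊆ys (there z∈xs)) (λ z≡x → All.lookup x∉xs z∈xs (sym z≡x))))
  where x∈ys = xs⊆ys (here refl)

Unique-++⁻ : ∀ xs {ys : List A} → Unique (xs ++ ys) → Unique xs × Unique ys × Disjoint xs ys
Unique-++⁻ []       u        = [] , u , λ { (() , _) }
Unique-++⁻ (x ∷ xs) (x∉ ∷ u) =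
  let xs-unique , ys-unique , xs#ys = Unique-++⁻ xs u
  in All.tabulate (λ v∈xs → All.lookup x∉ (∈-++⁺ˡ v∈xs)) ∷ xs-unique , ys-unique ,
     λ { (here refl , v∈ys) → All.lookup x∉ (∈-++⁺ʳ xs v∈ys) refl
       ; (there v∈xs , v∈ys) → xs#ys (v∈xs , v∈ys) }

count-≤-retraction : (p : A → Bool) (q : B → Bool) (f : A → B) (g : B → A) {xs : List A} {ys : List B} →
                     Unique xs →
                     (∀ {x} → x ∈ xs → T (p x) → f x ∈ ys × T (q (f x)) × g (f x) ≡ x) →
                     count p xs ≤ count q ys
count-≤-retraction p q f g {xs} {ys} xs-unique f-maps = begin
  count p xs             ≡⟨ sym (length-map f good) ⟩
  length (map f good)    ≤⟨ Unique-⊆⇒length≤ image-unique image⊆ ⟩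
  count q ys             ∎
  where
  open ≤-Reasoning
  good = filterᵇ p xs
  g∘f≡id : All (λ x → g (f x) ≡ x) good
  g∘f≡id = All.tabulate λ x∈good →
    let x∈xs , px = ∈-filter⁻ (T? ∘ p) x∈good in proj₂ (proj₂ (f-maps x∈xs px))
  g∘f-retracts : map g (map f good) ≡ good
  g∘f-retracts = trans (sym (map-∘ {g = g} {f = f} good)) (map-id-local g∘f≡id)
  image-unique : Unique (map f good)
  image-unique = Unique.map⁻ {f = g} (subst Unique (sym g∘f-retracts) (Unique.filter⁺ (T? ∘ p) xs-unique))
  image⊆ : map f good ⊆ filterᵇ q ys
  image⊆ fx∈ with ∈-map⁻ f fx∈
  ... | x , x∈good , refl =
    let x∈xs , px = ∈-filter⁻ (T? ∘ p) x∈good ; fx∈ys , qfx , _ = f-maps x∈xs px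
    in ∈-filter⁺ (T? ∘ q) fx∈ys qfx

count-bijection : (p : A → Bool) (q : B → Bool) (f : A → B) (g : B → A) {xs : List A} {ys : List B} →
                  Unique xs → Unique ys →
                  (∀ {x} → x ∈ xs → T (p x) → f x ∈ ys × T (q (f x)) × g (f x) ≡ x) →
                  (∀ {y} → y ∈ ys → T (q y) → g y ∈ xs × T (p (g y)) × f (g y) ≡ y) →
                  count p xs ≡ count q ys
count-bijection p q f g xs-unique ys-unique f-maps g-maps =
  ≤-antisym (count-≤-retraction p q f g xs-unique f-maps) (count-≤-retraction q p g f ys-unique g-maps)


-- Enumerations of words

concatMap-map≡cartesianProductWith : (f : A → B → C) (xs : List A) (ys : List B) →
                                     concatMap (λ x → map (f x) ys) xs ≡ cartesianProductWith f xs ys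
concatMap-map≡cartesianProductWith f []       ys = refl
concatMap-map≡cartesianProductWith f (x ∷ xs) ys = cong (map (f x) ys ++_) (concatMap-map≡cartesianProductWith f xs ys)

words-unique : ∀ n k → Unique (words n k)
words-unique n zero    = [] ∷ []
words-unique n (suc k) =
  subst Unique (sym (concatMap-map≡cartesianProductWith (λ w i → i ∷ w) (words n k) (allFin n)))
    (Unique.cartesianProductWith⁺ (λ w i → i ∷ w) (swap ∘ Vec.∷-injective) (words-unique n k) (Unique.allFin⁺ n))

∈-words : ∀ {n k} (w : Vec (Fin n) k) → w ∈ words n k
∈-words []      = here refl
∈-words {n} {suc k} (i ∷ w) =
  subst (i ∷ w ∈_) (sym (concatMap-map≡cartesianProductWith (λ w i → i ∷ w) (words n k) (allFin n)))
    (∈-cartesianProductWith⁺ (λ w i → i ∷ w) (∈-words w) (∈-allFin i))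

values : ∀ {m k} → Vec (Fin m) k → List ℕ
values []      = []
values (i ∷ w) = toℕ i ∷ values w

values-injective : ∀ {m k} {w w′ : Vec (Fin m) k} → values w ≡ values w′ → w ≡ w′
values-injective {w = []}    {[]}      _  = refl
values-injective {w = i ∷ w} {j ∷ w′} eq =
  cong₂ _∷_ (toℕ-injective (∷-injectiveˡ eq)) (values-injective (∷-injectiveʳ eq))

values≡tabulate : ∀ {m k} (w : Vec (Fin m) k) → values w ≡ tabulate (toℕ ∘ lookup w)
values≡tabulate []      = refl
values≡tabulate (i ∷ w) = cong (toℕ i ∷_) (values≡tabulate w)

length-values : ∀ {m k} (w : Vec (Fin m) k) → length (values w) ≡ k
length-values []      = refl
length-values (i ∷ w) = cong suc (length-values w)

values-< : ∀ {m k} (w : Vec (Fin m) k) → All (_< m) (values w)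
values-< []      = []
values-< (i ∷ w) = toℕ<n i ∷ values-< w

values-surjective : ∀ {m} k (L : List ℕ) → length L ≡ k → All (_< m) L → ∃ λ (w : Vec (Fin m) k) → values w ≡ L
values-surjective zero    []      _   _          = [] , refl
values-surjective (suc k) (x ∷ L) len (x<m ∷ L<m) =
  let w , w≡L = values-surjective k L (suc-injective len) L<m
  in fromℕ< x<m ∷ w , cong₂ _∷_ (toℕ-fromℕ< x<m) w≡L

sequences : ℕ → List (List ℕ)
sequences n = map values (words n n)

sequences-unique : ∀ n → Unique (sequences n)
sequences-unique n = Unique.map⁺ values-injective (words-unique n n)

∈-sequences⁺ : ∀ n {L} → length L ≡ n → All (_< n) L → L ∈ sequences n
∈-sequences⁺ n {L} len L<n with values-surjective n L len L<n
... | w , refl = ∈-map⁺ values (∈-words w)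

∈-sequences⁻ : ∀ n {L} → L ∈ sequences n → length L ≡ n × All (_< n) L
∈-sequences⁻ n L∈ with ∈-map⁻ values L∈
... | w , _ , refl = length-values w , values-< w

binaryWords : ℕ → List (List Bool)
binaryWords zero    = [] ∷ []
binaryWords (suc n) = cartesianProductWith _∷_ (false ∷ true ∷ []) (binaryWords n)

binaryWords-unique : ∀ n → Unique (binaryWords n)
binaryWords-unique zero    = [] ∷ []
binaryWords-unique (suc n) =
  Unique.cartesianProductWith⁺ _∷_ ∷-injective (((λ ()) ∷ []) ∷ [] ∷ []) (binaryWords-unique n)

∈-binaryWords : ∀ bs → bs ∈ binaryWords (length bs)
∈-binaryWords []           = here refl
∈-binaryWords (false ∷ bs) = ∈-cartesianProductWith⁺ _∷_ {xs = false ∷ true ∷ []} (here refl) (∈-binaryWords bs)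
∈-binaryWords (true  ∷ bs) = ∈-cartesianProductWith⁺ _∷_ {xs = false ∷ true ∷ []} (there (here refl)) (∈-binaryWords bs)

∈-binaryWords⁻ : ∀ n {bs} → bs ∈ binaryWords n → length bs ≡ n
∈-binaryWords⁻ zero    (here refl) = refl
∈-binaryWords⁻ (suc n) bs∈ with ∈-cartesianProductWith⁻ _∷_ (false ∷ true ∷ []) (binaryWords n) bs∈
... | _ , _ , _ , bs∈′ , refl = cong suc (∈-binaryWords⁻ n bs∈′)

count-binaryWords-suc : ∀ n (p : List Bool → Bool) →
  count p (binaryWords (suc n)) ≡ count (p ∘ (false ∷_)) (binaryWords n) + count (p ∘ (true ∷_)) (binaryWords n)
count-binaryWords-suc n p = begin
  count p (map (false ∷_) ws ++ map (true ∷_) ws ++ [])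
    ≡⟨ count-++ p (map (false ∷_) ws) _ ⟩
  count p (map (false ∷_) ws) + count p (map (true ∷_) ws ++ [])
    ≡⟨ cong (count p (map (false ∷_) ws) +_) (trans (count-++ p (map (true ∷_) ws) []) (+-identityʳ _)) ⟩
  count p (map (false ∷_) ws) + count p (map (true ∷_) ws)
    ≡⟨ cong₂ _+_ (count-map p (false ∷_) ws) (count-map p (true ∷_) ws) ⟩
  count (p ∘ (false ∷_)) ws + count (p ∘ (true ∷_)) ws
    ∎
  where
  open ≡-Reasoning
  ws = binaryWords n

length-binaryWords : ∀ n → length (binaryWords n) ≡ 2 ^ n
length-binaryWords zero    = refl
length-binaryWords (suc n) = begin
  length (binaryWords (suc n))                 ≡⟨ sym (count-true (binaryWords (suc n))) ⟩
  count (λ _ → true) (binaryWords (suc n))     ≡⟨ count-binaryWords-suc n (λ _ → true) ⟩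
  half + half                                  ≡⟨ cong (λ c → c + c) (trans (count-true (binaryWords n)) (length-binaryWords n)) ⟩
  2 ^ n + 2 ^ n                                ≡⟨ cong (2 ^ n +_) (sym (+-identityʳ (2 ^ n))) ⟩
  2 ^ suc n                                    ∎
  where
  open ≡-Reasoning
  half = count (λ _ → true) (binaryWords n)
  count-true : ∀ xs → count (λ _ → true) xs ≡ length xs
  count-true xs = count-all (λ _ → true) {xs} (All.tabulate (λ _ → _))


-- Permutation statistics of lists of naturals

length-concatMap : (h : A → List B) (xs : List A) → length (concatMap h xs) ≡ sum (map (length ∘ h) xs)
length-concatMap h []       = refl
length-concatMap h (x ∷ xs) = trans (length-++ (h x)) (cong (length (h x) +_) (length-concatMap h xs))

length-concatMap-allFin : ∀ {k} (h : Fin k → List B) → length (concatMap h (allFin k)) ≡ sum (tabulate (length ∘ h))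
length-concatMap-allFin h = trans (length-concatMap h (allFin _)) (cong sum (map-tabulate (λ i → i) (length ∘ h)))

count-tabulate : ∀ {k} (p : A → Bool) (g : Fin k → A) → count p (tabulate g) ≡ count (p ∘ g) (allFin k)
count-tabulate p g = trans (cong (count p) (sym (map-tabulate (λ i → i) g))) (count-map p g (allFin _))

and-tabulate-∧ : ∀ {k} (f g : Fin k → Bool) → and (tabulate (λ i → f i ∧ g i)) ≡ and (tabulate f) ∧ and (tabulate g)
and-tabulate-∧ {zero}  f g = refl
and-tabulate-∧ {suc k} f g with f fzero | g fzero
... | true  | true  = and-tabulate-∧ (f ∘ fsuc) (g ∘ fsuc)
... | true  | false = sym (∧-comm (and (tabulate (f ∘ fsuc))) false)
... | false | _     = refl

≡ᵇ-comm : ∀ m n → (m ≡ᵇ n) ≡ (n ≡ᵇ m)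
≡ᵇ-comm zero    zero    = refl
≡ᵇ-comm zero    (suc n) = refl
≡ᵇ-comm (suc m) zero    = refl
≡ᵇ-comm (suc m) (suc n) = ≡ᵇ-comm m n

infix 4 _∈ᵇ_

_∈ᵇ_ : ℕ → List ℕ → Bool
x ∈ᵇ []       = false
x ∈ᵇ (y ∷ ys) = (x ≡ᵇ y) ∨ (x ∈ᵇ ys)

distinctᵇ : List ℕ → Bool
distinctᵇ []       = true
distinctᵇ (x ∷ xs) = not (x ∈ᵇ xs) ∧ distinctᵇ xs

inversionsᴸ : List ℕ → ℕ
inversionsᴸ []       = 0
inversionsᴸ (x ∷ xs) = count (_<ᵇ x) xs + inversionsᴸ xs

descentsᴸ : List ℕ → ℕ
descentsᴸ []           = 0
descentsᴸ (x ∷ [])     = 0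
descentsᴸ (x ∷ y ∷ xs) = (if y <ᵇ x then 1 else 0) + descentsᴸ (y ∷ xs)

oddGrassmannianᵇ : List ℕ → Bool
oddGrassmannianᵇ L = distinctᵇ L ∧ atMostOne (descentsᴸ L) ∧ isOdd (inversionsᴸ L)

and-tabulate-∉ᵇ : ∀ {k} x (g : Fin k → ℕ) → and (tabulate (λ i → not (x ≡ᵇ g i))) ≡ not (x ∈ᵇ tabulate g)
and-tabulate-∉ᵇ {zero}  x g = refl
and-tabulate-∉ᵇ {suc k} x g with x ≡ᵇ g fzero
... | true  = refl
... | false = and-tabulate-∉ᵇ x (g ∘ fsuc)

inversions-tabulate : ∀ k (v : Fin k → ℕ) →
  sum (tabulate (λ i → count (λ j → (toℕ i <ᵇ toℕ j) ∧ (v j <ᵇ v i)) (allFin k))) ≡ inversionsᴸ (tabulate v)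
inversions-tabulate zero    v = refl
inversions-tabulate (suc k) v = cong₂ _+_
  (trans (count-tabulate (λ j → (0 <ᵇ toℕ j) ∧ (v j <ᵇ v fzero)) fsuc)
         (sym (count-tabulate (_<ᵇ v fzero) (v ∘ fsuc))))
  (trans (cong sum (tabulate-cong (λ i → count-tabulate (λ j → (suc (toℕ i) <ᵇ toℕ j) ∧ (v j <ᵇ v (fsuc i))) fsuc)))
         (inversions-tabulate k (v ∘ fsuc)))

descents-tabulate : ∀ k (v : Fin k → ℕ) →
  sum (tabulate (λ i → count (λ j → (suc (toℕ i) ≡ᵇ toℕ j) ∧ (v j <ᵇ v i)) (allFin k))) ≡ descentsᴸ (tabulate v)
descents-tabulate zero          v = refl
descents-tabulate (suc zero)    v = refl
descents-tabulate (suc (suc k)) v = cong₂ _+_ first-row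
  (trans (cong sum (tabulate-cong (λ i → count-tabulate (λ j → (suc (suc (toℕ i)) ≡ᵇ toℕ j) ∧ (v j <ᵇ v (fsuc i))) fsuc)))
         (descents-tabulate (suc k) (v ∘ fsuc)))
  where
  no-later-neighbour : count (λ j → (1 ≡ᵇ toℕ j) ∧ (v j <ᵇ v fzero)) (tabulate (fsuc ∘ fsuc)) ≡ 0
  no-later-neighbour = trans (count-tabulate (λ j → (1 ≡ᵇ toℕ j) ∧ (v j <ᵇ v fzero)) (fsuc ∘ fsuc))
                             (count-none (λ _ → false) {allFin k} (All.tabulate λ _ ()))
  first-row : count (λ j → (1 ≡ᵇ toℕ j) ∧ (v j <ᵇ v fzero)) (allFin (suc (suc k)))
            ≡ (if v (fsuc fzero) <ᵇ v fzero then 1 else 0)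
  first-row with v (fsuc fzero) <ᵇ v fzero
  ... | true  = cong suc no-later-neighbour
  ... | false = no-later-neighbour

distinct-tabulate : ∀ k (v : Fin k → ℕ) →
  and (tabulate (λ i → and (tabulate (λ j → (toℕ i ≡ᵇ toℕ j) ∨ not (v i ≡ᵇ v j))))) ≡ distinctᵇ (tabulate v)
distinct-tabulate zero    v = refl
distinct-tabulate (suc k) v = begin
  fresh ∧ and (tabulate (λ i → not (v (fsuc i) ≡ᵇ v fzero) ∧ rows i))
    ≡⟨ cong (fresh ∧_) (and-tabulate-∧ _ rows) ⟩
  fresh ∧ (and (tabulate (λ i → not (v (fsuc i) ≡ᵇ v fzero))) ∧ and (tabulate rows))
    ≡⟨ cong (λ b → fresh ∧ (b ∧ and (tabulate rows))) column≡fresh ⟩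
  fresh ∧ (fresh ∧ and (tabulate rows))
    ≡⟨ sym (∧-assoc fresh fresh _) ⟩
  (fresh ∧ fresh) ∧ and (tabulate rows)
    ≡⟨ cong₂ _∧_ (∧-idem fresh) (distinct-tabulate k (v ∘ fsuc)) ⟩
  fresh ∧ distinctᵇ (tabulate (v ∘ fsuc))
    ≡⟨ cong (_∧ distinctᵇ (tabulate (v ∘ fsuc))) (and-tabulate-∉ᵇ (v fzero) (v ∘ fsuc)) ⟩
  distinctᵇ (tabulate v)
    ∎
  where
  open ≡-Reasoning
  rows : Fin k → Bool
  rows i = and (tabulate (λ j → (toℕ i ≡ᵇ toℕ j) ∨ not (v (fsuc i) ≡ᵇ v (fsuc j))))
  fresh : Bool
  fresh = and (tabulate (λ j → not (v fzero ≡ᵇ v (fsuc j))))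
  column≡fresh : and (tabulate (λ i → not (v (fsuc i) ≡ᵇ v fzero))) ≡ fresh
  column≡fresh = cong and (tabulate-cong (λ i → cong not (≡ᵇ-comm (v (fsuc i)) (v fzero))))

inversions-values : ∀ {n} (w : Vec (Fin n) n) → inversions w ≡ inversionsᴸ (values w)
inversions-values {n} w = trans (length-concatMap-allFin (λ i → filterᵇ (λ j → (toℕ i <ᵇ toℕ j) ∧ (v j <ᵇ v i)) (allFin n)))
  (trans (inversions-tabulate n v) (cong inversionsᴸ (sym (values≡tabulate w))))
  where v = toℕ ∘ lookup w

descents-values : ∀ {n} (w : Vec (Fin n) n) → descents w ≡ descentsᴸ (values w)
descents-values {n} w = trans (length-concatMap-allFin (λ i → filterᵇ (λ j → (suc (toℕ i) ≡ᵇ toℕ j) ∧ (v j <ᵇ v i)) (allFin n)))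
  (trans (descents-tabulate n v) (cong descentsᴸ (sym (values≡tabulate w))))
  where v = toℕ ∘ lookup w

isPerm-values : ∀ {n} (w : Vec (Fin n) n) → isPerm w ≡ distinctᵇ (values w)
isPerm-values {n} w = begin
  isPerm w
    ≡⟨ cong and (map-tabulate (λ i → i) row) ⟩
  and (tabulate (λ i → and (map (λ j → (toℕ i ≡ᵇ toℕ j) ∨ not (v i ≡ᵇ v j)) (allFin n))))
    ≡⟨ cong and (tabulate-cong (λ i → cong and (map-tabulate (λ j → j) (entry i)))) ⟩
  and (tabulate (λ i → and (tabulate (λ j → (toℕ i ≡ᵇ toℕ j) ∨ not (v i ≡ᵇ v j)))))
    ≡⟨ distinct-tabulate n v ⟩
  distinctᵇ (tabulate v)
    ≡⟨ cong distinctᵇ (sym (values≡tabulate w)) ⟩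
  distinctᵇ (values w)
    ∎
  where
  open ≡-Reasoning
  v = toℕ ∘ lookup w
  entry : Fin n → Fin n → Bool
  entry i j = (toℕ i ≡ᵇ toℕ j) ∨ not (v i ≡ᵇ v j)
  row : Fin n → Bool
  row i = and (map (entry i) (allFin n))

a≡count-sequences : ∀ n → a n ≡ count oddGrassmannianᵇ (sequences n)
a≡count-sequences n = sym (trans (count-map oddGrassmannianᵇ values (words n n)) (count-cong agree (words n n)))
  where
  agree : ∀ w → oddGrassmannianᵇ (values w) ≡ (isPerm w ∧ atMostOne (descents w) ∧ isOdd (inversions w))
  agree w rewrite isPerm-values w | descents-values w | inversions-values w = refl

T-not⇒¬T : ∀ {b} → T (not b) → ¬ T b
T-not⇒¬T {false} _ ()

¬T⇒T-not : ∀ {b} → ¬ T b → T (not b)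
¬T⇒T-not {false} _  = _
¬T⇒T-not {true}  ¬t = ¬t _

¬T⇒≡false : ∀ {b} → ¬ T b → b ≡ false
¬T⇒≡false {false} _  = refl
¬T⇒≡false {true}  ¬t = ⊥-elim (¬t _)

∈ᵇ⇒∈ : ∀ {x} xs → T (x ∈ᵇ xs) → x ∈ xs
∈ᵇ⇒∈ {x} (y ∷ ys) t with to T-∨ t
... | inj₁ x≡ᵇy = here (≡ᵇ⇒≡ x y x≡ᵇy)
... | inj₂ x∈ᵇys = there (∈ᵇ⇒∈ ys x∈ᵇys)

∈⇒∈ᵇ : ∀ {x xs} → x ∈ xs → T (x ∈ᵇ xs)
∈⇒∈ᵇ {x} (here refl) = from T-∨ (inj₁ (≡⇒≡ᵇ x x refl))
∈⇒∈ᵇ (there x∈xs)    = from T-∨ (inj₂ (∈⇒∈ᵇ x∈xs))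

distinctᵇ⇒Unique : ∀ xs → T (distinctᵇ xs) → Unique xs
distinctᵇ⇒Unique []       _ = []
distinctᵇ⇒Unique (x ∷ xs) t =
  let x∉ᵇxs , xs-distinct = to T-∧ t
  in All.tabulate (λ y∈xs x≡y → T-not⇒¬T x∉ᵇxs (∈⇒∈ᵇ (subst (_∈ xs) (sym x≡y) y∈xs)))
     ∷ distinctᵇ⇒Unique xs xs-distinct

Unique⇒distinctᵇ : ∀ {xs} → Unique xs → T (distinctᵇ xs)
Unique⇒distinctᵇ []                = _
Unique⇒distinctᵇ {x ∷ xs} (x∉ ∷ u) =
  from T-∧ (¬T⇒T-not (λ t → All.lookup x∉ (∈ᵇ⇒∈ xs t) refl) , Unique⇒distinctᵇ u)

T-atMostOne⇒≤1 : ∀ d → T (atMostOne d) → d ≤ 1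
T-atMostOne⇒≤1 zero          _ = z≤n
T-atMostOne⇒≤1 (suc zero)    _ = s≤s z≤n

≤1⇒T-atMostOne : ∀ {d} → d ≤ 1 → T (atMostOne d)
≤1⇒T-atMostOne z≤n       = _
≤1⇒T-atMostOne (s≤s z≤n) = _


-- Increasing lists

Increasing : List ℕ → Set
Increasing = AllPairs _<_

Increasing⇒Unique : ∀ {xs} → Increasing xs → Unique xs
Increasing⇒Unique = AllPairs.map <⇒≢

head-≤ : ∀ {y ys v} → Increasing (y ∷ ys) → v ∈ y ∷ ys → y ≤ v
head-≤ _        (here refl)  = ≤-refl
head-≤ (y< ∷ _) (there v∈ys) = <⇒≤ (All.lookup y< v∈ys)

≥⇒¬T-<ᵇ : ∀ {m n} → n ≤ m → ¬ T (m <ᵇ n)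
≥⇒¬T-<ᵇ {m} {n} n≤m t = ≤⇒≯ n≤m (<ᵇ⇒< m n t)

≥⇒<ᵇ≡false : ∀ {m n} → n ≤ m → (m <ᵇ n) ≡ false
≥⇒<ᵇ≡false = ¬T⇒≡false ∘ ≥⇒¬T-<ᵇ

Increasing-≡ : ∀ {xs ys} → Increasing xs → Increasing ys → xs ⊆ ys → ys ⊆ xs → xs ≡ ys
Increasing-≡ {[]}     {[]}     _ _ _ _ = refl
Increasing-≡ {[]}     {y ∷ ys} _ _ _ ys⊆ with ys⊆ (here refl)
... | ()
Increasing-≡ {x ∷ xs} {[]}     _ _ xs⊆ _ with xs⊆ (here refl)
... | ()
Increasing-≡ {x ∷ xs} {y ∷ ys} ixs@(x< ∷ ixs′) iys@(y< ∷ iys′) xs⊆ ys⊆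
  with ≤-antisym (head-≤ iys (xs⊆ (here refl))) (head-≤ ixs (ys⊆ (here refl)))
... | refl = cong (x ∷_) (Increasing-≡ ixs′ iys′ (tail⊆ x< xs⊆) (tail⊆ y< ys⊆))
  where
  tail⊆ : ∀ {zs zs′} → All (x <_) zs → x ∷ zs ⊆ x ∷ zs′ → zs ⊆ zs′
  tail⊆ x<zs sub v∈zs with sub (there v∈zs)
  ... | here refl = ⊥-elim (<-irrefl refl (All.lookup x<zs v∈zs))
  ... | there v∈zs′ = v∈zs′

Increasing⇒descents≡0 : ∀ {xs} → Increasing xs → descentsᴸ xs ≡ 0
Increasing⇒descents≡0 []                 = refl
Increasing⇒descents≡0 (_ ∷ [])           = refl
Increasing⇒descents≡0 ((x<y ∷ _) ∷ iys) rewrite ≥⇒<ᵇ≡false (<⇒≤ x<y) = Increasing⇒descents≡0 iys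

descents-++-Increasing : ∀ {xs ys} → Increasing xs → Increasing ys → descentsᴸ (xs ++ ys) ≤ 1
descents-++-Increasing {[]}         _ iys = ≤-trans (≤-reflexive (Increasing⇒descents≡0 iys)) z≤n
descents-++-Increasing {x ∷ []} {[]} _ _  = z≤n
descents-++-Increasing {x ∷ []} {y ∷ ys} _ iys rewrite Increasing⇒descents≡0 iys with y <ᵇ x
... | true  = ≤-refl
... | false = z≤n
descents-++-Increasing {x ∷ x′ ∷ xs} ((x<x′ ∷ _) ∷ ixs) iys rewrite ≥⇒<ᵇ≡false (<⇒≤ x<x′) =
  descents-++-Increasing ixs iys

crossings : List ℕ → List ℕ → ℕ
crossings []       ys = 0
crossings (x ∷ xs) ys = count (_<ᵇ x) ys + crossings xs ys

inversions-++ : ∀ xs ys → inversionsᴸ (xs ++ ys) ≡ inversionsᴸ xs + inversionsᴸ ys + crossings xs ys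
inversions-++ []       ys = sym (+-identityʳ _)
inversions-++ (x ∷ xs) ys rewrite count-++ (_<ᵇ x) xs ys | inversions-++ xs ys =
  rearrange (count (_<ᵇ x) xs) (count (_<ᵇ x) ys) (inversionsᴸ xs) (inversionsᴸ ys) (crossings xs ys)
  where
  rearrange : ∀ a b c d e → a + b + (c + d + e) ≡ a + c + d + (b + e)
  rearrange = solve-∀

Increasing⇒inversions≡0 : ∀ {xs} → Increasing xs → inversionsᴸ xs ≡ 0
Increasing⇒inversions≡0 []                = refl
Increasing⇒inversions≡0 {x ∷ _} (x< ∷ ixs) =
  cong₂ _+_ (count-none (_<ᵇ x) (All.map (≥⇒¬T-<ᵇ ∘ <⇒≤) x<)) (Increasing⇒inversions≡0 ixs)

crossings-∷ : ∀ xs y ys → crossings xs (y ∷ ys) ≡ count (y <ᵇ_) xs + crossings xs ys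
crossings-∷ []       y ys = refl
crossings-∷ (x ∷ xs) y ys rewrite crossings-∷ xs y ys with y <ᵇ x
... | true  = cong suc (x∙yz≈y∙xz (count (_<ᵇ x) ys) (count (y <ᵇ_) xs) (crossings xs ys))
... | false = x∙yz≈y∙xz (count (_<ᵇ x) ys) (count (y <ᵇ_) xs) (crossings xs ys)

crossings≢0⇒∃ : ∀ xs ys → crossings xs ys ≢ 0 → ∃ λ x → ∃ λ y → x ∈ xs × y ∈ ys × y < x
crossings≢0⇒∃ []       ys c≢0 = ⊥-elim (c≢0 refl)
crossings≢0⇒∃ (x ∷ xs) ys c≢0 with count (_<ᵇ x) ys ≟ 0
... | yes none = let x′ , y , x′∈ , y∈ , y<x′ = crossings≢0⇒∃ xs ys (c≢0 ∘ trans (cong (_+ crossings xs ys) none))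
                 in x′ , y , there x′∈ , y∈ , y<x′
... | no some  = let y , y∈ , y<ᵇx = count≢0⇒∃ (_<ᵇ x) ys some
                 in x , y , here refl , y∈ , <ᵇ⇒< y x y<ᵇx

range : ℕ → ℕ → List ℕ
range k zero    = []
range k (suc m) = k ∷ range (suc k) m

length-range : ∀ k m → length (range k m) ≡ m
length-range k zero    = refl
length-range k (suc m) = cong suc (length-range (suc k) m)

∈-range⁻ : ∀ k m {v} → v ∈ range k m → k ≤ v × v < k + m
∈-range⁻ k (suc m) (here refl) = ≤-refl , m<m+n k z<s
∈-range⁻ k (suc m) (there v∈)  =
  let k<v , v<k+m = ∈-range⁻ (suc k) m v∈ in <⇒≤ k<v , <-≤-trans v<k+m (≤-reflexive (sym (+-suc k m)))

∈-range⁺ : ∀ k m {v} → k ≤ v → v < k + m → v ∈ range k m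
∈-range⁺ k zero    k≤v v<k+m = ⊥-elim (<-irrefl refl (≤-<-trans k≤v (<-≤-trans v<k+m (≤-reflexive (+-identityʳ k)))))
∈-range⁺ k (suc m) {v} k≤v v<k+m with k ≟ v
... | yes refl = here refl
... | no  k≢v  = there (∈-range⁺ (suc k) m (≤∧≢⇒< k≤v k≢v) (<-≤-trans v<k+m (≤-reflexive (+-suc k m))))

range-increasing : ∀ k m → Increasing (range k m)
range-increasing k zero    = []
range-increasing k (suc m) = All.tabulate (proj₁ ∘ ∈-range⁻ (suc k) m) ∷ range-increasing (suc k) m

pigeonhole : ∀ n {L} → Unique L → length L ≡ n → All (_< n) L → ∀ {v} → v < n → v ∈ L
pigeonhole n {L} L-unique len L<n {v} v<n with v ∈? L
... | yes v∈L = v∈L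
... | no  v∉L = ⊥-elim (<-irrefl refl (begin-strict
  n                    ≡⟨ sym len ⟩
  length L             <⟨ ≤-refl ⟩
  length (v ∷ L)       ≤⟨ Unique-⊆⇒length≤ (All.tabulate (λ v′∈L v≡v′ → v∉L (subst (_∈ L) (sym v≡v′) v′∈L)) ∷ L-unique) v∷L⊆range ⟩
  length (range 0 n)   ≡⟨ length-range 0 n ⟩
  n                    ∎))
  where
  open ≤-Reasoning
  v∷L⊆range : ∀ {u} → u ∈ v ∷ L → u ∈ range 0 n
  v∷L⊆range (here refl) = ∈-range⁺ 0 n z≤n v<n
  v∷L⊆range (there u∈L) = ∈-range⁺ 0 n z≤n (All.lookup L<n u∈L)

filterᵇ-range-≡ : ∀ n (P : ℕ → Bool) {xs} → Increasing xs →
                  (∀ {v} → v ∈ xs → v < n × T (P v)) → (∀ {v} → v < n → T (P v) → v ∈ xs) →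
                  filterᵇ P (range 0 n) ≡ xs
filterᵇ-range-≡ n P ixs xs⇒ ⇒xs = Increasing-≡ (AllPairs.filter⁺ (T? ∘ P) (range-increasing 0 n)) ixs
  (λ v∈ → let v∈range , Pv = ∈-filter⁻ (T? ∘ P) v∈ in ⇒xs (proj₂ (∈-range⁻ 0 n v∈range)) Pv)
  (λ v∈ → let v<n , Pv = xs⇒ v∈ in ∈-filter⁺ (T? ∘ P) (∈-range⁺ 0 n z≤n v<n) Pv)


-- Grassmannian permutations as shuffles of binary words

positions : ℕ → List Bool → List ℕ
positions k []           = []
positions k (true  ∷ bs) = k ∷ positions (suc k) bs
positions k (false ∷ bs) = positions (suc k) bs

shuffle : List Bool → List ℕ
shuffle bs = positions 0 bs ++ positions 0 (map not bs)

ones : List Bool → ℕ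
ones []           = 0
ones (true  ∷ bs) = suc (ones bs)
ones (false ∷ bs) = ones bs

zeroOnePairs : List Bool → ℕ
zeroOnePairs []           = 0
zeroOnePairs (true  ∷ bs) = zeroOnePairs bs
zeroOnePairs (false ∷ bs) = ones bs + zeroOnePairs bs

positions-≥ : ∀ k bs → All (k ≤_) (positions k bs)
positions-≥ k []           = []
positions-≥ k (true  ∷ bs) = ≤-refl ∷ All.map (≤-trans (n≤1+n k)) (positions-≥ (suc k) bs)
positions-≥ k (false ∷ bs) = All.map (≤-trans (n≤1+n k)) (positions-≥ (suc k) bs)

positions-< : ∀ k bs → All (_< k + length bs) (positions k bs)
positions-< k []           = []
positions-< k (true  ∷ bs) = m<m+n k z<s ∷ All.map (λ p → <-≤-trans p (≤-reflexive (sym (+-suc k _)))) (positions-< (suc k) bs)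
positions-< k (false ∷ bs) = All.map (λ p → <-≤-trans p (≤-reflexive (sym (+-suc k _)))) (positions-< (suc k) bs)

positions-increasing : ∀ k bs → Increasing (positions k bs)
positions-increasing k []           = []
positions-increasing k (true  ∷ bs) = positions-≥ (suc k) bs ∷ positions-increasing (suc k) bs
positions-increasing k (false ∷ bs) = positions-increasing (suc k) bs

length-positions : ∀ k bs → length (positions k bs) ≡ ones bs
length-positions k []           = refl
length-positions k (true  ∷ bs) = cong suc (length-positions (suc k) bs)
length-positions k (false ∷ bs) = length-positions (suc k) bs

positions-disjoint : ∀ k bs {v} → v ∈ positions k bs → v ∉ positions k (map not bs)
positions-disjoint k (true  ∷ bs) (here refl) v∈ = <-irrefl refl (All.lookup (positions-≥ (suc k) (map not bs)) v∈)
positions-disjoint k (true  ∷ bs) (there v∈)  v∈′ = positions-disjoint (suc k) bs v∈ v∈′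
positions-disjoint k (false ∷ bs) v∈ (here refl)  = <-irrefl refl (All.lookup (positions-≥ (suc k) bs) v∈)
positions-disjoint k (false ∷ bs) v∈ (there v∈′)  = positions-disjoint (suc k) bs v∈ v∈′

length-shuffle : ∀ bs → length (shuffle bs) ≡ length bs
length-shuffle bs = trans (length-++ (positions 0 bs)) (split 0 bs)
  where
  split : ∀ k bs → length (positions k bs) + length (positions k (map not bs)) ≡ length bs
  split k []           = refl
  split k (true  ∷ bs) = cong suc (split (suc k) bs)
  split k (false ∷ bs) = trans (+-suc _ _) (cong suc (split (suc k) bs))

shuffle-< : ∀ bs → All (_< length bs) (shuffle bs)
shuffle-< bs = All.++⁺ (positions-< 0 bs) (subst (λ n → All (_< n) (positions 0 (map not bs))) (length-map not bs) (positions-< 0 (map not bs)))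

shuffle-unique : ∀ bs → Unique (shuffle bs)
shuffle-unique bs = Unique.++⁺ (Increasing⇒Unique (positions-increasing 0 bs))
                               (Increasing⇒Unique (positions-increasing 0 (map not bs)))
                               (λ (v∈ , v∈′) → positions-disjoint 0 bs v∈ v∈′)

descents-shuffle : ∀ bs → descentsᴸ (shuffle bs) ≤ 1
descents-shuffle bs = descents-++-Increasing (positions-increasing 0 bs) (positions-increasing 0 (map not bs))

crossings-positions : ∀ k bs → crossings (positions k bs) (positions k (map not bs)) ≡ zeroOnePairs bs
crossings-positions k []           = refl
crossings-positions k (true  ∷ bs) =
  cong₂ _+_ (count-none (_<ᵇ k) (All.map (≥⇒¬T-<ᵇ ∘ <⇒≤) (positions-≥ (suc k) (map not bs))))
            (crossings-positions (suc k) bs)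
crossings-positions k (false ∷ bs) = begin
  crossings (positions (suc k) bs) (k ∷ positions (suc k) (map not bs))
    ≡⟨ crossings-∷ (positions (suc k) bs) k _ ⟩
  count (k <ᵇ_) (positions (suc k) bs) + crossings (positions (suc k) bs) (positions (suc k) (map not bs))
    ≡⟨ cong₂ _+_ (trans (count-all (k <ᵇ_) (All.map <⇒<ᵇ (positions-≥ (suc k) bs))) (length-positions (suc k) bs))
                 (crossings-positions (suc k) bs) ⟩
  ones bs + zeroOnePairs bs
    ∎
  where open ≡-Reasoning

inversions-shuffle : ∀ bs → inversionsᴸ (shuffle bs) ≡ zeroOnePairs bs
inversions-shuffle bs
  rewrite inversions-++ (positions 0 bs) (positions 0 (map not bs))
        | Increasing⇒inversions≡0 (positions-increasing 0 bs)
        | Increasing⇒inversions≡0 (positions-increasing 0 (map not bs))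
  = crossings-positions 0 bs

shuffle-oddGrassmannian : ∀ bs → T (isOdd (zeroOnePairs bs)) → T (oddGrassmannianᵇ (shuffle bs))
shuffle-oddGrassmannian bs odd =
  from T-∧ (Unique⇒distinctᵇ (shuffle-unique bs) ,
  from T-∧ (≤1⇒T-atMostOne (descents-shuffle bs) , subst (T ∘ isOdd) (sym (inversions-shuffle bs)) odd))

positions-map-range : ∀ (P : ℕ → Bool) k m → positions k (map P (range k m)) ≡ filterᵇ P (range k m)
positions-map-range P k zero    = refl
positions-map-range P k (suc m) with P k
... | true  = cong (k ∷_) (positions-map-range P (suc k) m)
... | false = positions-map-range P (suc k) m

map-∈ᵇ-positions : ∀ k bs → map (_∈ᵇ positions k bs) (range k (length bs)) ≡ bs
map-∈ᵇ-positions k []           = refl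
map-∈ᵇ-positions k (true  ∷ bs) rewrite to T-≡ (≡⇒≡ᵇ k k refl) = cong (true ∷_) (begin
  map (λ v → (v ≡ᵇ k) ∨ (v ∈ᵇ positions (suc k) bs)) (range (suc k) (length bs))
    ≡⟨ map-cong-local (All.tabulate (λ {v} v∈ → cong (_∨ (v ∈ᵇ positions (suc k) bs))
                                       (¬T⇒≡false (k<v⇒¬v≡ᵇk (proj₁ (∈-range⁻ (suc k) (length bs) v∈)))))) ⟩
  map (_∈ᵇ positions (suc k) bs) (range (suc k) (length bs))
    ≡⟨ map-∈ᵇ-positions (suc k) bs ⟩
  bs
    ∎)
  where
  open ≡-Reasoning
  k<v⇒¬v≡ᵇk : ∀ {v} → k < v → ¬ T (v ≡ᵇ k)
  k<v⇒¬v≡ᵇk k<v t = <-irrefl (sym (≡ᵇ⇒≡ _ k t)) k<v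
map-∈ᵇ-positions k (false ∷ bs)
  rewrite ¬T⇒≡false (λ t → <-irrefl refl (All.lookup (positions-≥ (suc k) bs) (∈ᵇ⇒∈ (positions (suc k) bs) t)))
  = cong (false ∷_) (map-∈ᵇ-positions (suc k) bs)

descentSplit : List ℕ → List ℕ × List ℕ
descentSplit []           = [] , []
descentSplit (x ∷ [])     = x ∷ [] , []
descentSplit (x ∷ y ∷ xs) = if y <ᵇ x then (x ∷ [] , y ∷ xs) else map₁ (x ∷_) (descentSplit (y ∷ xs))

descentSplit-++ : ∀ L → proj₁ (descentSplit L) ++ proj₂ (descentSplit L) ≡ L
descentSplit-++ []           = refl
descentSplit-++ (x ∷ [])     = refl
descentSplit-++ (x ∷ y ∷ xs) with ih ← descentSplit-++ (y ∷ xs) | y <ᵇ x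
... | true  = refl
... | false = cong (x ∷_) ih

descentSplit-head : ∀ y xs → ∃ λ r → proj₁ (descentSplit (y ∷ xs)) ≡ y ∷ r
descentSplit-head y []       = [] , refl
descentSplit-head y (z ∷ xs) with z <ᵇ y
... | true  = [] , refl
... | false = _ , refl

descents-prefix≡0 : ∀ L → descentsᴸ (proj₁ (descentSplit L)) ≡ 0
descents-prefix≡0 []           = refl
descents-prefix≡0 (x ∷ [])     = refl
descents-prefix≡0 (x ∷ y ∷ xs) with ih ← descents-prefix≡0 (y ∷ xs) | y <ᵇ x in y<ᵇx
... | true  = refl
... | false with descentSplit-head y xs
...   | r , prefix≡y∷r rewrite prefix≡y∷r | y<ᵇx = ih

descents-suffix≡0 : ∀ L → descentsᴸ L ≤ 1 → descentsᴸ (proj₂ (descentSplit L)) ≡ 0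
descents-suffix≡0 []           _ = refl
descents-suffix≡0 (x ∷ [])     _ = refl
descents-suffix≡0 (x ∷ y ∷ xs) d with ih ← descents-suffix≡0 (y ∷ xs) | y <ᵇ x
... | true  = n≤0⇒n≡0 (s≤s⁻¹ d)
... | false = ih d

Unique∧descents≡0⇒Increasing : ∀ L → Unique L → descentsᴸ L ≡ 0 → Increasing L
Unique∧descents≡0⇒Increasing []           _ _ = []
Unique∧descents≡0⇒Increasing (x ∷ [])     _ _ = [] ∷ []
Unique∧descents≡0⇒Increasing (x ∷ y ∷ xs) ((x≢y ∷ _) ∷ u) d with y <ᵇ x in y<ᵇx
... | true  = ⊥-elim (1+n≢0 d)
... | false with Unique∧descents≡0⇒Increasing (y ∷ xs) u d
...   | iys@(y< ∷ _) = (x<y ∷ All.map (<-trans x<y) y<) ∷ iys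
  where x<y = ≤∧≢⇒< (≮⇒≥ (λ y<x → subst T y<ᵇx (<⇒<ᵇ y<x))) x≢y

descentSplit-cut : ∀ {xs ys x y} → Increasing xs → Increasing ys → x ∈ xs → y ∈ ys → y < x →
                   descentSplit (xs ++ ys) ≡ (xs , ys)
descentSplit-cut {x₀ ∷ []} {y₀ ∷ ys} _ iys (here refl) y∈ y<x₀
  rewrite to T-≡ (<⇒<ᵇ (≤-<-trans (head-≤ iys y∈) y<x₀)) = refl
descentSplit-cut {x₀ ∷ x₁ ∷ xs} ((x₀<x₁ ∷ _) ∷ ixs) iys (here refl) y∈ y<x₀
  rewrite ≥⇒<ᵇ≡false (<⇒≤ x₀<x₁) | descentSplit-cut ixs iys (here refl) y∈ (<-trans y<x₀ x₀<x₁) = refl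
descentSplit-cut {x₀ ∷ x₁ ∷ xs} ((x₀<x₁ ∷ _) ∷ ixs) iys (there x∈) y∈ y<x
  rewrite ≥⇒<ᵇ≡false (<⇒≤ x₀<x₁) | descentSplit-cut ixs iys x∈ y∈ y<x = refl

toWord : ℕ → List ℕ → List Bool
toWord n L = map (_∈ᵇ proj₁ (descentSplit L)) (range 0 n)

length-toWord : ∀ n L → length (toWord n L) ≡ n
length-toWord n L = trans (length-map _ (range 0 n)) (length-range 0 n)

-- An odd word has a 0 before a 1, so the first descent of shuffle bs is where its two runs meet.
toWord-shuffle : ∀ bs → T (isOdd (zeroOnePairs bs)) → toWord (length bs) (shuffle bs) ≡ bs
toWord-shuffle bs odd
  with _ , _ , x∈ , y∈ , y<x ← crossings≢0⇒∃ (positions 0 bs) (positions 0 (map not bs))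
                                  (λ c≡0 → subst (T ∘ isOdd) (trans (sym (crossings-positions 0 bs)) c≡0) odd)
  rewrite descentSplit-cut (positions-increasing 0 bs) (positions-increasing 0 (map not bs)) x∈ y∈ y<x
  = map-∈ᵇ-positions 0 bs

shuffle-toWord : ∀ n {L} → Unique L → length L ≡ n → All (_< n) L → descentsᴸ L ≤ 1 → shuffle (toWord n L) ≡ L
shuffle-toWord n {L} L-unique len L<n d = begin
  positions 0 (map P (range 0 n)) ++ positions 0 (map not (map P (range 0 n)))
    ≡⟨ cong₂ _++_ (positions-map-range P 0 n)
                  (trans (cong (positions 0) (sym (map-∘ (range 0 n)))) (positions-map-range (not ∘ P) 0 n)) ⟩
  filterᵇ P (range 0 n) ++ filterᵇ (not ∘ P) (range 0 n)
    ≡⟨ cong₂ _++_ prefix-filter suffix-filter ⟩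
  R ++ S
    ≡⟨ descentSplit-++ L ⟩
  L ∎
  where
  open ≡-Reasoning
  R = proj₁ (descentSplit L)
  S = proj₂ (descentSplit L)
  P : ℕ → Bool
  P = _∈ᵇ R
  L≡R++S : L ≡ R ++ S
  L≡R++S = sym (descentSplit-++ L)
  parts = Unique-++⁻ R (subst Unique L≡R++S L-unique)
  R#S : Disjoint R S
  R#S = proj₂ (proj₂ parts)
  R++S< : All (_< n) (R ++ S)
  R++S< = subst (All (_< n)) L≡R++S L<n
  prefix-filter : filterᵇ P (range 0 n) ≡ R
  prefix-filter = filterᵇ-range-≡ n P (Unique∧descents≡0⇒Increasing R (proj₁ parts) (descents-prefix≡0 L))
    (λ v∈R → All.lookup R++S< (∈-++⁺ˡ v∈R) , ∈⇒∈ᵇ v∈R)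
    (λ _ v∈ᵇR → ∈ᵇ⇒∈ R v∈ᵇR)
  suffix-filter : filterᵇ (not ∘ P) (range 0 n) ≡ S
  suffix-filter = filterᵇ-range-≡ n (not ∘ P) (Unique∧descents≡0⇒Increasing S (proj₁ (proj₂ parts)) (descents-suffix≡0 L d))
    (λ v∈S → All.lookup R++S< (∈-++⁺ʳ R v∈S) , ¬T⇒T-not (λ v∈ᵇR → R#S (∈ᵇ⇒∈ R v∈ᵇR , v∈S)))
    (λ v<n v∉ᵇR → [ (λ v∈R → ⊥-elim (T-not⇒¬T v∉ᵇR (∈⇒∈ᵇ v∈R))) , (λ v∈S → v∈S) ]′
                    (∈-++⁻ R (subst (_ ∈_) L≡R++S (pigeonhole n L-unique len L<n v<n))))

oddWords : ℕ → ℕ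
oddWords n = count (isOdd ∘ zeroOnePairs) (binaryWords n)

a≡oddWords : ∀ n → a n ≡ oddWords n
a≡oddWords n = trans (a≡count-sequences n)
  (count-bijection oddGrassmannianᵇ (isOdd ∘ zeroOnePairs) (toWord n) shuffle
                   (sequences-unique n) (binaryWords-unique n) toWord-maps shuffle-maps)
  where
  toWord-maps : ∀ {L} → L ∈ sequences n → T (oddGrassmannianᵇ L) →
                toWord n L ∈ binaryWords n × T (isOdd (zeroOnePairs (toWord n L))) × shuffle (toWord n L) ≡ L
  toWord-maps {L} L∈ t =
    let len , L<n      = ∈-sequences⁻ n L∈
        distinct , t′  = to T-∧ t
        atMostOne , odd = to T-∧ t′
        inverse = shuffle-toWord n (distinctᵇ⇒Unique L distinct) len L<n (T-atMostOne⇒≤1 _ atMostOne)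
    in subst (λ k → toWord n L ∈ binaryWords k) (length-toWord n L) (∈-binaryWords (toWord n L)) ,
       subst (T ∘ isOdd) (trans (sym (cong inversionsᴸ inverse)) (inversions-shuffle (toWord n L))) odd ,
       inverse
  shuffle-maps : ∀ {bs} → bs ∈ binaryWords n → T (isOdd (zeroOnePairs bs)) →
                 shuffle bs ∈ sequences n × T (oddGrassmannianᵇ (shuffle bs)) × toWord n (shuffle bs) ≡ bs
  shuffle-maps {bs} bs∈ odd with ∈-binaryWords⁻ n bs∈
  ... | refl = ∈-sequences⁺ (length bs) (length-shuffle bs) (shuffle-< bs) ,
               shuffle-oddGrassmannian bs odd ,
               toWord-shuffle bs odd


-- Counting binary words by parities

isOdd-suc : ∀ n → isOdd (suc n) ≡ not (isOdd n)
isOdd-suc n with isOdd n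
... | true  = refl
... | false = refl

isOdd-+ : ∀ m n → isOdd (m + n) ≡ isOdd m xor isOdd n
isOdd-+ zero    n = refl
isOdd-+ (suc m) n = begin
  isOdd (suc (m + n))         ≡⟨ isOdd-suc (m + n) ⟩
  not (isOdd (m + n))         ≡⟨ cong not (isOdd-+ m n) ⟩
  not (isOdd m xor isOdd n)   ≡⟨ not-distribˡ-xor (isOdd m) (isOdd n) ⟩
  not (isOdd m) xor isOdd n   ≡⟨ cong (_xor isOdd n) (sym (isOdd-suc m)) ⟩
  isOdd (suc m) xor isOdd n   ∎
  where open ≡-Reasoning

parityCount : ℕ → (Bool → Bool → Bool) → ℕ
parityCount n f = count (λ bs → f (isOdd (ones bs)) (isOdd (zeroOnePairs bs))) (binaryWords n)

parityCount-cong : ∀ n {f g : Bool → Bool → Bool} → (∀ o z → f o z ≡ g o z) → parityCount n f ≡ parityCount n g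
parityCount-cong n f≗g = count-cong (λ bs → f≗g _ _) (binaryWords n)

parityCount-suc : ∀ n f → parityCount (suc n) f ≡ parityCount n (λ o z → f o (o xor z)) + parityCount n (λ o z → f (not o) z)
parityCount-suc n f = trans (count-binaryWords-suc n _) (cong₂ _+_
  (count-cong (λ bs → cong (f (isOdd (ones bs))) (isOdd-+ (ones bs) (zeroOnePairs bs))) (binaryWords n))
  (count-cong (λ bs → cong (λ o → f o (isOdd (zeroOnePairs bs))) (isOdd-suc (ones bs))) (binaryWords n)))

parityCount-complement : ∀ n f → parityCount n (λ o z → not (f o z)) + parityCount n f ≡ 2 ^ n
parityCount-complement n f = trans (count-not+count _ (binaryWords n)) (length-binaryWords n)

oddWords-recurrence : ∀ n → oddWords (2 + n) ≡ 2 * oddWords n + 2 ^ n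
oddWords-recurrence n = begin
  parityCount (2 + n) (λ _ z → z)
    ≡⟨ parityCount-suc (suc n) (λ _ z → z) ⟩
  parityCount (1 + n) _xor_ + parityCount (1 + n) (λ _ z → z)
    ≡⟨ cong₂ _+_ (parityCount-suc n _xor_) (parityCount-suc n (λ _ z → z)) ⟩
  (parityCount n (λ o z → o xor (o xor z)) + parityCount n (λ o z → not o xor z)) + (parityCount n _xor_ + odd)
    ≡⟨ cong₂ (λ x y → (x + y) + (parityCount n _xor_ + odd))
             (parityCount-cong n xor-cancelˡ) (parityCount-cong n (λ o z → sym (not-distribˡ-xor o z))) ⟩
  (odd + parityCount n (λ o z → not (o xor z))) + (parityCount n _xor_ + odd)
    ≡⟨ rearrange odd _ _ ⟩
  2 * odd + (parityCount n (λ o z → not (o xor z)) + parityCount n _xor_)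
    ≡⟨ cong (2 * odd +_) (parityCount-complement n _xor_) ⟩
  2 * odd + 2 ^ n
    ∎
  where
  open ≡-Reasoning
  odd = oddWords n
  xor-cancelˡ : ∀ o z → o xor (o xor z) ≡ z
  xor-cancelˡ o z = trans (sym (xor-assoc o o z)) (cong (_xor z) (xor-same o))
  rearrange : ∀ a b c → (a + b) + (c + a) ≡ 2 * a + (b + c)
  rearrange = solve-∀

a-recurrence : ∀ n → a (2 + n) ≡ 2 * a n + 2 ^ n
a-recurrence n rewrite a≡oddWords (2 + n) | a≡oddWords n = oddWords-recurrence n


mainTheorem11 : (a 1 ≡ 0) × (a 2 ≡ 1) ×
                  ((n : ℕ) → n > 2 → a n ≡ 2 * a (n ∸ 2) + 2 ^ (n ∸ 2))
mainTheorem11 = refl , refl , recurrence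
  where
  recurrence : (n : ℕ) → n > 2 → a n ≡ 2 * a (n ∸ 2) + 2 ^ (n ∸ 2)
  recurrence 1             (s≤s ())
  recurrence (suc (suc n)) _ = a-recurrence n
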